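{- Let $(G,A,k,\ell)$ be an instance of $(A,\ell)$-Path Packing with $\ell\ge 5$, and let $M\subseteq V(G)$ be a vertex cover of $G$. Let $I=V(G)\setminus M$ and $A_I=I\cap A$, and suppose $|A_I|>2|M\setminus A|$. Let $H_1$ be the bipartite graph with parts $L_1=M\setminus A$ and $R_1=A_I$, whose edges are the edges $uv\in E(G)$ with $u\in L_1$, $v\in R_1$. Suppose $\widehat{L_1}\subseteq L_1$, $\widehat{R_1}\subseteq R_1$ and $\mathcal{M}\subseteq E(H_1)$ satisfy: - $\mathcal{M}$ is a $2$-expansion of $\widehat{L_1}$ onto $\widehat{R_1}$; - $N_{H_1}(\widehat{R_1})\subseteq \widehat{L_1}$; - $|R_1\setminus\widehat{R_1}|\le 2|L_1\setminus\widehat{L_1}|$. Let $v\in\widehat{R_1}$ be a vertex not incident to any edge of $\mathcal{M}$. Then $(G,A,k,\ell)$ is a yes-instance if and only if $(G-v,A\setminus\{v\},k,\ell)$ is a yes-instance.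
   Context: For an undirected graph $G$ and $A\subseteq V(G)$, an $A$-path is a path in $G$ that starts and ends at two distinct vertices of $A$ and whose internal vertices all lie in $V(G)\setminus A$. $(A,\ell)$-Path Packing asks, given $G$, $A\subseteq V(G)$ and integers $k,\ell$, whether $G$ has $k$ pairwise vertex-disjoint $A$-paths each of length exactly $\ell$. For a bipartite graph $H$ with parts $(L,R)$, $\widehat L\subseteq L$ and $\widehat R\subseteq R$, a set $\mathcal{M}\subseteq E(H)$ is a $2$-expansion of $\widehat L$ onto $\widehat R$ if the following hold: (i) every edge of $\mathcal{M}$ has one endpoint in $\widehat L$ and the other in $\widehat R$; (ii) every vertex of $\widehat L$ is incident to exactly $2$ edges of $\mathcal{M}$; (iii) exactly $2|\widehat L|$ vertices of $\widehat R$ are incident to edges of $\mathcal{M}$. -}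

module Defs where

open import Data.Nat using (ℕ; zero; suc; _+_; _*_; _≤_; _<_)
open import Data.Bool using (Bool; true; false; _∨_)
open import Data.Fin using (Fin; zero; suc; inject₁; fromℕ; punchIn)
open import Data.Fin.Subset using (Subset; _∈_; _∉_; _⊆_; _∩_; _─_; ∁; ∣_∣)
open import Data.Vec using (tabulate; lookup)
open import Data.List using (allFin)
open import Data.Bool.ListAction using (any)
open import Data.Product using (Σ; _×_; _,_)
open import Data.Sum using (_⊎_)
open import Relation.Binary.PropositionalEquality using (_≡_; _≢_)
open import Function.Definitions using (Injective)

record Graph (n : ℕ) : Set where
  field
    adj    : Fin n → Fin n → Bool
    sym    : ∀ u v → adj u v ≡ adj v u
    irrefl : ∀ u → adj u u ≡ false
open Graph public

Edge : ∀ {n} → Graph n → Fin n → Fin n → Set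
Edge G u v = adj G u v ≡ true

IsVertexCover : ∀ {n} → Graph n → Subset n → Set
IsVertexCover G M = ∀ u v → Edge G u v → (u ∈ M) ⊎ (v ∈ M)

IsAPath : ∀ {n} → Graph n → Subset n → (ℓ : ℕ) → (Fin (suc ℓ) → Fin n) → Set
IsAPath G A ℓ p =
  Injective _≡_ _≡_ p
  × (∀ (i : Fin ℓ) → Edge G (p (inject₁ i)) (p (suc i)))
  × p zero ∈ A × p (fromℕ ℓ) ∈ A × p zero ≢ p (fromℕ ℓ)
  × (∀ i → i ≢ zero → i ≢ fromℕ ℓ → p i ∉ A)

YesInstance : ∀ {n} → Graph n → Subset n → ℕ → ℕ → Set
YesInstance {n} G A k ℓ =
  Σ (Fin k → Fin (suc ℓ) → Fin n) λ P →
    (∀ i → IsAPath G A ℓ (P i))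
    × (∀ i j a b → P i a ≡ P j b → i ≡ j)

deleteVertex : ∀ {n} → Graph (suc n) → Fin (suc n) → Graph n
deleteVertex G v = record
  { adj = λ a b → adj G (punchIn v a) (punchIn v b)
  ; sym = λ a b → sym G (punchIn v a) (punchIn v b)
  ; irrefl = λ a → irrefl G (punchIn v a) }

removeVertex : ∀ {n} → Subset (suc n) → Fin (suc n) → Subset n
removeVertex A v = tabulate λ a → lookup A (punchIn v a)

-- Edge sets of a bipartite graph are given by Boolean relations 𝓜 u w,
-- oriented with u the left endpoint and w the right endpoint.
incident : ∀ {n} → (Fin n → Fin n → Bool) → Fin n → Fin n → Bool
incident 𝓜 x y = 𝓜 x y ∨ 𝓜 y x

edgeNbrs : ∀ {n} → (Fin n → Fin n → Bool) → Fin n → Subset n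
edgeNbrs 𝓜 x = tabulate λ y → incident 𝓜 x y

covered : ∀ {n} → (Fin n → Fin n → Bool) → Subset n
covered {n} 𝓜 = tabulate λ y → any (λ x → incident 𝓜 x y) (allFin n)

IsTwoExpansion : ∀ {n} → Subset n → Subset n → (Fin n → Fin n → Bool) → Set
IsTwoExpansion Lhat Rhat 𝓜 =
  (∀ u w → 𝓜 u w ≡ true → u ∈ Lhat × w ∈ Rhat)
  × (∀ u → u ∈ Lhat → ∣ edgeNbrs 𝓜 u ∣ ≡ 2)
  × ∣ covered 𝓜 ∩ Rhat ∣ ≡ 2 * ∣ Lhat ∣

H1Edge : ∀ {n} → Graph n → Subset n → Subset n → Fin n → Fin n → Set
H1Edge G A M u w = u ∈ (M ─ A) × w ∈ (∁ M ∩ A) × Edge G u w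

{-# OPTIONS --safe #-}
module Submission where

open import Defs
open import Data.Nat using (ℕ; suc; _*_; _≤_; _<_)
open import Data.Bool using (Bool; true; false)
open import Data.Fin using (Fin)
open import Data.Fin.Subset using (Subset; _∈_; _⊆_; _∩_; _─_; ∁; ∣_∣)
open import Relation.Binary.PropositionalEquality using (_≡_)
open import Function.Bundles using (_⇔_)

open import Data.Bool using (T; _∨_)
open import Data.Bool.Properties using (¬-not; ∨-identityʳ; T-≡) renaming (_≟_ to _≟ᵇ_)
open import Data.Empty using (⊥)
open import Data.Fin using (zero; suc; inject₁; fromℕ; punchIn; punchOut)
open import Data.Fin.Properties
  using (_≟_; any?; suc-injective; fromℕ≢inject₁; punchIn-injective; punchIn-punchOut; punchInᵢ≢i)
open import Data.Fin.Subset using (_∉_)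
open import Data.Fin.Subset.Properties using (_∈?_; x∈p∩q⁻; p─q⊆p; x∈p∧x∉q⇒x∈p─q; x∈∁p⇒x∉p)
open import Data.List using (allFin)
open import Data.List.Relation.Unary.Any using (satisfied)
open import Data.List.Relation.Unary.Any.Properties using (any⁻)
open import Data.Nat using (zero; _+_; z≤n; s≤s)
open import Data.Nat.Properties
  using (+-*-semiring; 1+n≢0; ≤-trans; ≤-reflexive; +-mono-≤; +-monoʳ-≤; +-cancelʳ-≤; m≤m+n; module ≤-Reasoning)
open import Algebra.Properties.Semiring.Sum +-*-semiring
  using (sum; sum-syntax; sum-cong-≗; sum-remove; sum-replicate-zero; ∑-comm; *-distribˡ-sum)
open import Data.Product using (Σ; ∃; _×_; _,_; proj₁; proj₂)
open import Data.Sum as Sum using (_⊎_; inj₁; inj₂; [_,_]′)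
open import Data.Vec using (lookup; tabulate; []; _∷_)
open import Data.Vec.Functional using (Vector; updateAt; removeAt)
open import Data.Vec.Functional.Properties using (updateAt-updates; updateAt-minimal)
open import Data.Vec.Properties using ([]=⇒lookup; lookup⇒[]=; lookup∘tabulate)
open import Function using (_∘_; id; const; flip; case_of_)
open import Function.Bundles using (mk⇔; Equivalence)
open import Relation.Binary.PropositionalEquality as ≡
  using (refl; trans; cong; subst; subst₂; _≢_; module ≡-Reasoning)
open import Relation.Nullary using (yes; no; contradiction)

-- A vertex r of Rhat lies in A but not in the vertex cover M, so on an A-path it can only be an
-- endpoint, and its neighbour on the path lies in M \ A and hence, as N(Rhat) ⊆ Lhat, in Lhat.
-- Double counting the edges of the 2-expansion shows that every vertex of Rhat has at most one
-- 𝓜-neighbour, so sending each vertex of Lhat to one of its 𝓜-neighbours is injective.  Replacing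
-- every endpoint in Rhat by the chosen 𝓜-neighbour of the next vertex on its path (for ℓ ≥ 3 the two
-- ends of a path use different next vertices) therefore yields disjoint A-paths of length ℓ, and all
-- their vertices in Rhat are covered by 𝓜, so none of them is v.

indicator : Bool → ℕ
indicator true  = 1
indicator false = 0

indicator≤1 : ∀ b → indicator b ≤ 1
indicator≤1 true  = s≤s z≤n
indicator≤1 false = z≤n

sum-mono-≤ : ∀ {m} {f g : Vector ℕ m} → (∀ i → f i ≤ g i) → sum f ≤ sum g
sum-mono-≤ {zero}  f≤g = z≤n
sum-mono-≤ {suc m} f≤g = +-mono-≤ (f≤g zero) (sum-mono-≤ (f≤g ∘ suc))

≤-sum : ∀ {m} (f : Vector ℕ m) i → f i ≤ sum f
≤-sum {suc m} f i = ≤-trans (m≤m+n (f i) _) (≤-reflexive (≡.sym (sum-remove {i = i} f)))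

+-≤-sum : ∀ {m} (f : Vector ℕ m) {i j} → i ≢ j → f i + f j ≤ sum f
+-≤-sum {suc m} f {i} {j} i≢j = begin
  f i + f j                               ≡⟨ cong (λ k → f i + f k) (punchIn-punchOut i≢j) ⟨
  f i + removeAt f i (punchOut i≢j)       ≤⟨ +-monoʳ-≤ (f i) (≤-sum (removeAt f i) _) ⟩
  f i + sum (removeAt f i)                ≡⟨ sum-remove f ⟨
  sum f                                   ∎
  where open ≤-Reasoning

sum-mono-≤-tight : ∀ {m} {f g : Vector ℕ m} → (∀ i → f i ≤ g i) → sum g ≤ sum f → ∀ i → g i ≤ f i
sum-mono-≤-tight {suc m} {f} {g} f≤g ∑g≤∑f i = +-cancelʳ-≤ (sum (removeAt g i)) (g i) (f i) (begin
  g i + sum (removeAt g i)   ≡⟨ sum-remove g ⟨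
  sum g                      ≤⟨ ∑g≤∑f ⟩
  sum f                      ≡⟨ sum-remove f ⟩
  f i + sum (removeAt f i)   ≤⟨ +-monoʳ-≤ (f i) (sum-mono-≤ (f≤g ∘ punchIn i)) ⟩
  f i + sum (removeAt g i)   ∎)
  where open ≤-Reasoning

∑indicator≤1⇒unique : ∀ {m} (p : Vector Bool m) → sum (indicator ∘ p) ≤ 1 →
                      ∀ {i j} → p i ≡ true → p j ≡ true → i ≡ j
∑indicator≤1⇒unique p ∑≤1 {i} {j} pi pj with i ≟ j
... | yes i≡j = i≡j
... | no i≢j  = contradiction (≤-trans (+-≤-sum (indicator ∘ p) i≢j) ∑≤1) 2≰1
  where
  2≰1 : indicator (p i) + indicator (p j) ≤ 1 → ⊥
  2≰1 rewrite pi | pj = λ { (s≤s ()) }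

∑indicator≢0⇒∃ : ∀ {m} (p : Vector Bool m) → sum (indicator ∘ p) ≢ 0 → ∃ λ i → p i ≡ true
∑indicator≢0⇒∃ {zero}  p ∑≢0 = contradiction refl ∑≢0
∑indicator≢0⇒∃ {suc m} p ∑≢0 with p zero in eq
... | true  = zero , eq
... | false = let i , pi = ∑indicator≢0⇒∃ (p ∘ suc) ∑≢0 in suc i , pi

∣p∣≡∑ : ∀ {m} (p : Subset m) → ∣ p ∣ ≡ ∑[ i < m ] indicator (lookup p i)
∣p∣≡∑ []          = refl
∣p∣≡∑ (true ∷ p)  = cong suc (∣p∣≡∑ p)
∣p∣≡∑ (false ∷ p) = ∣p∣≡∑ p

∈-tabulate : ∀ {m} {f : Fin m → Bool} {x} → x ∈ tabulate f ⇔ f x ≡ true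
∈-tabulate {f = f} {x} = mk⇔
  (λ x∈ → trans (≡.sym (lookup∘tabulate f x)) ([]=⇒lookup x∈))
  (λ fx → lookup⇒[]= x _ (trans (lookup∘tabulate f x) fx))

partner : ∀ {n} → (Fin n → Fin n → Bool) → Fin n → Fin n
partner 𝓜 x with any? (λ y → 𝓜 x y ≟ᵇ true)
... | yes (y , _) = y
... | no _        = x

partner-spec : ∀ {n} (𝓜 : Fin n → Fin n → Bool) {x y} → 𝓜 x y ≡ true → 𝓜 x (partner 𝓜 x) ≡ true
partner-spec 𝓜 {x} {y} 𝓜xy with any? (λ y → 𝓜 x y ≟ᵇ true)
... | yes (_ , 𝓜xz) = 𝓜xz
... | no ∄          = contradiction (y , 𝓜xy) ∄

module TwoExpansion {n} {Lhat Rhat : Subset n} {𝓜 : Fin n → Fin n → Bool}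
    (Lhat∩Rhat≡∅ : ∀ {x} → x ∈ Lhat → x ∉ Rhat)
    (expansion : IsTwoExpansion Lhat Rhat 𝓜) where

  private
    𝓜⊆Lhat×Rhat : ∀ u w → 𝓜 u w ≡ true → u ∈ Lhat × w ∈ Rhat
    𝓜⊆Lhat×Rhat = proj₁ expansion
    degree-two : ∀ u → u ∈ Lhat → ∣ edgeNbrs 𝓜 u ∣ ≡ 2
    degree-two = proj₁ (proj₂ expansion)
    ∣covered∣ : ∣ covered 𝓜 ∩ Rhat ∣ ≡ 2 * ∣ Lhat ∣
    ∣covered∣ = proj₂ (proj₂ expansion)

  outDegree inDegree : Fin n → ℕ
  outDegree x = ∑[ y < n ] indicator (𝓜 x y)
  inDegree  y = ∑[ x < n ] indicator (𝓜 x y)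

  incident≡𝓜 : ∀ {x y} → 𝓜 y x ≡ false → incident 𝓜 x y ≡ 𝓜 x y
  incident≡𝓜 {x} {y} 𝓜yx = trans (cong (𝓜 x y ∨_) 𝓜yx) (∨-identityʳ (𝓜 x y))

  outDegree-Lhat : ∀ {x} → x ∈ Lhat → outDegree x ≡ 2
  outDegree-Lhat {x} x∈Lhat = begin
    outDegree x                                     ≡⟨ sum-cong-≗ (cong indicator ∘ incident≡𝓜 ∘ no-edge-into) ⟨
    ∑[ y < n ] indicator (incident 𝓜 x y)           ≡⟨ sum-cong-≗ (cong indicator ∘ lookup∘tabulate (incident 𝓜 x)) ⟨
    ∑[ y < n ] indicator (lookup (edgeNbrs 𝓜 x) y)  ≡⟨ ∣p∣≡∑ (edgeNbrs 𝓜 x) ⟨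
    ∣ edgeNbrs 𝓜 x ∣                                ≡⟨ degree-two x x∈Lhat ⟩
    2                                               ∎
    where
    open ≡-Reasoning
    no-edge-into : ∀ y → 𝓜 y x ≡ false
    no-edge-into y = ¬-not λ 𝓜yx → Lhat∩Rhat≡∅ x∈Lhat (proj₂ (𝓜⊆Lhat×Rhat y x 𝓜yx))

  outDegree-∉Lhat : ∀ {x} → x ∉ Lhat → outDegree x ≡ 0
  outDegree-∉Lhat {x} x∉Lhat =
    trans (sum-cong-≗ λ y → cong indicator (¬-not λ 𝓜xy → x∉Lhat (proj₁ (𝓜⊆Lhat×Rhat x y 𝓜xy))))
          (sum-replicate-zero n)

  outDegree≡ : ∀ x → outDegree x ≡ 2 * indicator (lookup Lhat x)
  outDegree≡ x with lookup Lhat x in eq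
  ... | true  = outDegree-Lhat (lookup⇒[]= x Lhat eq)
  ... | false = outDegree-∉Lhat λ x∈Lhat → contradiction (trans (≡.sym ([]=⇒lookup x∈Lhat)) eq) λ ()

  ∑outDegree≡∑covered : ∑[ x < n ] outDegree x ≡ ∑[ y < n ] indicator (lookup (covered 𝓜 ∩ Rhat) y)
  ∑outDegree≡∑covered = begin
    ∑[ x < n ] outDegree x                                ≡⟨ sum-cong-≗ outDegree≡ ⟩
    ∑[ x < n ] (2 * indicator (lookup Lhat x))            ≡⟨ *-distribˡ-sum 2 (indicator ∘ lookup Lhat) ⟨
    2 * (∑[ x < n ] indicator (lookup Lhat x))            ≡⟨ cong (2 *_) (∣p∣≡∑ Lhat) ⟨
    2 * ∣ Lhat ∣                                          ≡⟨ ∣covered∣ ⟨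
    ∣ covered 𝓜 ∩ Rhat ∣                                  ≡⟨ ∣p∣≡∑ (covered 𝓜 ∩ Rhat) ⟩
    ∑[ y < n ] indicator (lookup (covered 𝓜 ∩ Rhat) y)    ∎
    where open ≡-Reasoning

  covered≤inDegree : ∀ y → indicator (lookup (covered 𝓜 ∩ Rhat) y) ≤ inDegree y
  covered≤inDegree y with lookup (covered 𝓜 ∩ Rhat) y in eq
  ... | false = z≤n
  ... | true  = subst (_≤ inDegree y) (cong indicator 𝓜xy) (≤-sum (λ x → indicator (𝓜 x y)) x)
    where
    y∈covered×Rhat : y ∈ covered 𝓜 × y ∈ Rhat
    y∈covered×Rhat = x∈p∩q⁻ (covered 𝓜) Rhat (lookup⇒[]= y _ eq)
    witness : ∃ λ x → T (incident 𝓜 x y)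
    witness = satisfied (any⁻ _ (allFin n) (Equivalence.from T-≡ (Equivalence.to ∈-tabulate (proj₁ y∈covered×Rhat))))
    x : Fin n
    x = proj₁ witness
    𝓜xy : 𝓜 x y ≡ true
    𝓜xy = trans (≡.sym (incident≡𝓜 (¬-not λ 𝓜yx →
             Lhat∩Rhat≡∅ (proj₁ (𝓜⊆Lhat×Rhat y x 𝓜yx)) (proj₂ y∈covered×Rhat))))
           (Equivalence.to T-≡ (proj₂ witness))

  -- Double counting: inDegree dominates the indicator of covered 𝓜 ∩ Rhat pointwise, while
  -- ∑ inDegree = ∑ outDegree = 2 ∣Lhat∣ = ∣covered 𝓜 ∩ Rhat∣; so the two agree pointwise.
  inDegree≤1 : ∀ y → inDegree y ≤ 1
  inDegree≤1 y = ≤-trans (sum-mono-≤-tight covered≤inDegree ∑inDegree≤∑covered y) (indicator≤1 _)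
    where
    ∑inDegree≤∑covered : ∑[ y < n ] inDegree y ≤ ∑[ y < n ] indicator (lookup (covered 𝓜 ∩ Rhat) y)
    ∑inDegree≤∑covered = ≤-reflexive (trans (≡.sym (∑-comm (λ x y → indicator (𝓜 x y)))) ∑outDegree≡∑covered)

  out-neighbour : ∀ {x} → x ∈ Lhat → ∃ λ y → 𝓜 x y ≡ true
  out-neighbour {x} x∈Lhat = ∑indicator≢0⇒∃ (𝓜 x) (1+n≢0 ∘ trans (≡.sym (outDegree-Lhat x∈Lhat)))

  partner-matched : ∀ {x} → x ∈ Lhat → 𝓜 x (partner 𝓜 x) ≡ true
  partner-matched x∈Lhat = partner-spec 𝓜 (proj₂ (out-neighbour x∈Lhat))

  partner-injective : ∀ {x x′} → x ∈ Lhat → x′ ∈ Lhat → partner 𝓜 x ≡ partner 𝓜 x′ → x ≡ x′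
  partner-injective {x′ = x′} x∈Lhat x′∈Lhat eq = ∑indicator≤1⇒unique (λ x → 𝓜 x _) (inDegree≤1 _)
    (partner-matched x∈Lhat) (subst (λ y → 𝓜 x′ y ≡ true) (≡.sym eq) (partner-matched x′∈Lhat))

  partner≢unmatched : ∀ {x w} → (∀ u → incident 𝓜 u w ≡ false) → x ∈ Lhat → partner 𝓜 x ≢ w
  partner≢unmatched {x} {w} w-unmatched x∈Lhat refl =
    contradiction (trans (≡.sym (w-unmatched x)) (cong (_∨ 𝓜 w x) (partner-matched x∈Lhat))) λ ()

data EndView {ℓ} : Fin (suc ℓ) → Set where
  start : EndView zero
  end   : EndView (fromℕ ℓ)
  inner : ∀ {a} → a ≢ zero → a ≢ fromℕ ℓ → EndView a

endView : ∀ {ℓ} (a : Fin (suc ℓ)) → EndView a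
endView {ℓ} a with a ≟ zero | a ≟ fromℕ ℓ
... | yes refl | _        = start
... | no _     | yes refl = end
... | no a≢0   | no a≢ℓ   = inner a≢0 a≢ℓ

withEnds : ∀ {X : Set} {ℓ} → X → X → Vector X (suc ℓ) → Vector X (suc ℓ)
withEnds {ℓ = ℓ} x y p = updateAt (updateAt p zero (const x)) (fromℕ ℓ) (const y)

module _ {X : Set} {ℓ} (x y : X) (p : Vector X (suc (suc ℓ))) where

  withEnds-end : withEnds x y p (fromℕ (suc ℓ)) ≡ y
  withEnds-end = updateAt-updates (fromℕ (suc ℓ)) (updateAt p zero (const x))

  withEnds-inner : ∀ {a} → a ≢ zero → a ≢ fromℕ (suc ℓ) → withEnds x y p a ≡ p a
  withEnds-inner {a} a≢0 a≢ℓ = trans (updateAt-minimal a _ _ a≢ℓ) (updateAt-minimal a zero p a≢0)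

module _ {n} (G : Graph n) where

  Edge-sym : ∀ {u v} → Edge G u v → Edge G v u
  Edge-sym {u} {v} = trans (sym G v u)

  withEnds-isAPath : ∀ {A m} {p : Fin (3 + m) → Fin n} {x y} → IsAPath G A (2 + m) p →
                     x ∈ A → y ∈ A → x ≢ y →
                     Edge G x (p (suc zero)) → Edge G (p (inject₁ (fromℕ (suc m)))) y →
                     IsAPath G A (2 + m) (withEnds x y p)
  withEnds-isAPath {A} {m} {p} {x} {y} (p-injective , p-edge , _ , _ , _ , p-inner∉A) x∈A y∈A x≢y x~p₁ pₗ~y =
    injective , edge , x∈A , end∈A , x≢y ∘ flip trans (withEnds-end x y p) , inner∉A
    where
    q : Fin (3 + m) → Fin n
    q = withEnds x y p
    inner∉A : ∀ a → a ≢ zero → a ≢ fromℕ (2 + m) → q a ∉ A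
    inner∉A a a≢0 a≢ℓ = subst (_∉ A) (≡.sym (withEnds-inner x y p a≢0 a≢ℓ)) (p-inner∉A a a≢0 a≢ℓ)
    end∈A : q (fromℕ (2 + m)) ∈ A
    end∈A = subst (_∈ A) (≡.sym (withEnds-end x y p)) y∈A
    ∈A-∉A : ∀ {u w} → u ∈ A → w ∉ A → u ≢ w
    ∈A-∉A u∈A w∉A u≡w = w∉A (subst (_∈ A) u≡w u∈A)
    injective : ∀ {a b} → q a ≡ q b → a ≡ b
    injective {a} {b} qa≡qb with endView a | endView b
    ... | start         | start         = refl
    ... | end           | end           = refl
    ... | start         | end           = contradiction (trans qa≡qb (withEnds-end x y p)) x≢y
    ... | end           | start         = contradiction (trans (≡.sym qa≡qb) (withEnds-end x y p)) x≢y
    ... | start         | inner b≢0 b≢ℓ = contradiction qa≡qb (∈A-∉A x∈A (inner∉A b b≢0 b≢ℓ))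
    ... | end           | inner b≢0 b≢ℓ = contradiction qa≡qb (∈A-∉A end∈A (inner∉A b b≢0 b≢ℓ))
    ... | inner a≢0 a≢ℓ | start         = contradiction (≡.sym qa≡qb) (∈A-∉A x∈A (inner∉A a a≢0 a≢ℓ))
    ... | inner a≢0 a≢ℓ | end           = contradiction (≡.sym qa≡qb) (∈A-∉A end∈A (inner∉A a a≢0 a≢ℓ))
    ... | inner a≢0 a≢ℓ | inner b≢0 b≢ℓ =
      p-injective (trans (≡.sym (withEnds-inner x y p a≢0 a≢ℓ)) (trans qa≡qb (withEnds-inner x y p b≢0 b≢ℓ)))
    edge : ∀ s → Edge G (q (inject₁ s)) (q (suc s))
    edge zero = subst (Edge G x) (≡.sym (withEnds-inner x y p (λ ()) (λ ()))) x~p₁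
    edge (suc s) with s ≟ fromℕ m
    ... | yes refl = subst₂ (Edge G) (≡.sym (withEnds-inner x y p (λ ()) penult≢last)) (≡.sym (withEnds-end x y p)) pₗ~y
      where
      penult≢last : inject₁ (fromℕ (suc m)) ≢ fromℕ (2 + m)
      penult≢last = fromℕ≢inject₁ ∘ ≡.sym
    ... | no s≢ℓ = subst₂ (Edge G)
      (≡.sym (withEnds-inner x y p (λ ()) (fromℕ≢inject₁ ∘ ≡.sym)))
      (≡.sym (withEnds-inner x y p (λ ()) (s≢ℓ ∘ suc-injective ∘ suc-injective)))
      (p-edge (suc s))

YesInstanceAvoiding : ∀ {n} → Graph n → Subset n → ℕ → ℕ → Fin n → Set
YesInstanceAvoiding G A k ℓ v = Σ (YesInstance G A k ℓ) λ packing → ∀ i a → proj₁ packing i a ≢ v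

module _ {n} (G : Graph (suc n)) (A : Subset (suc n)) (v : Fin (suc n)) where

  ∈-removeVertex : ∀ {x} → x ∈ removeVertex A v ⇔ punchIn v x ∈ A
  ∈-removeVertex = mk⇔ (lookup⇒[]= _ A ∘ Equivalence.to ∈-tabulate) (Equivalence.from ∈-tabulate ∘ []=⇒lookup)

  isAPath-deleteVertex : ∀ {ℓ q p} → (∀ a → punchIn v (q a) ≡ p a) →
                         IsAPath (deleteVertex G v) (removeVertex A v) ℓ q ⇔ IsAPath G A ℓ p
  isAPath-deleteVertex {ℓ} {q} {p} q≗p = mk⇔
    (λ (injective , edge , start∈A , end∈A , start≢end , inner∉A) →
        injective ∘ from q≡⇔p≡
      , (λ s → subst₂ (Edge G) (q≗p _) (q≗p _) (edge s))
      , subst (_∈ A) (q≗p _) (to ∈-removeVertex start∈A)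
      , subst (_∈ A) (q≗p _) (to ∈-removeVertex end∈A)
      , start≢end ∘ from q≡⇔p≡
      , λ a a≢0 a≢ℓ → inner∉A a a≢0 a≢ℓ ∘ from ∈-removeVertex ∘ subst (_∈ A) (≡.sym (q≗p a)))
    (λ (injective , edge , start∈A , end∈A , start≢end , inner∉A) →
        injective ∘ to q≡⇔p≡
      , (λ s → subst₂ (Edge G) (≡.sym (q≗p _)) (≡.sym (q≗p _)) (edge s))
      , from ∈-removeVertex (subst (_∈ A) (≡.sym (q≗p _)) start∈A)
      , from ∈-removeVertex (subst (_∈ A) (≡.sym (q≗p _)) end∈A)
      , start≢end ∘ to q≡⇔p≡
      , λ a a≢0 a≢ℓ → inner∉A a a≢0 a≢ℓ ∘ subst (_∈ A) (q≗p a) ∘ to ∈-removeVertex)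
    where
    open Equivalence
    q≡⇔p≡ : ∀ {a b} → q a ≡ q b ⇔ p a ≡ p b
    q≡⇔p≡ {a} {b} = mk⇔
      (λ e → trans (≡.sym (q≗p a)) (trans (cong (punchIn v) e) (q≗p b)))
      (λ e → punchIn-injective v _ _ (trans (q≗p a) (trans e (≡.sym (q≗p b)))))

  yesInstance-deleteVertex : ∀ {k ℓ} →
    YesInstance (deleteVertex G v) (removeVertex A v) k ℓ ⇔ YesInstanceAvoiding G A k ℓ v
  yesInstance-deleteVertex = mk⇔
    (λ (Q , paths , disjoint) →
        ( (λ i a → punchIn v (Q i a))
        , (λ i → Equivalence.to (isAPath-deleteVertex (λ _ → refl)) (paths i))
        , (λ i j a b → disjoint i j a b ∘ punchIn-injective v _ _))
      , λ i a → punchInᵢ≢i v (Q i a))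
    (λ ((P , paths , disjoint) , avoids) →
      let Q i a = punchOut (avoids i a ∘ ≡.sym) in
        Q
      , (λ i → Equivalence.from (isAPath-deleteVertex (λ _ → punchIn-punchOut _)) (paths i))
      , λ i j a b Qia≡Qjb → disjoint i j a b
          (trans (≡.sym (punchIn-punchOut _)) (trans (cong (punchIn v) Qia≡Qjb) (punchIn-punchOut _))))

module Rerouting {n} (G : Graph n) (A R L : Subset n) (f : Fin n → Fin n) (v : Fin n)
    (R⊆A : R ⊆ A)
    (R-neighbour∈L : ∀ {r x} → r ∈ R → Edge G r x → x ∉ A → x ∈ L)
    (f-edge : ∀ {x} → x ∈ L → Edge G x (f x))
    (f∈R : ∀ {x} → x ∈ L → f x ∈ R)
    (f-injective : ∀ {x x′} → x ∈ L → x′ ∈ L → f x ≡ f x′ → x ≡ x′)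
    (f≢v : ∀ {x} → x ∈ L → f x ≢ v)
    (v∈R : v ∈ R) where

  Image : Fin n → Fin n → Set
  Image x q = (q ≡ x × x ∉ R) ⊎ (q ≡ f x × x ∈ L)

  Image-injective : ∀ {x x′ q} → Image x q → Image x′ q → x ≡ x′
  Image-injective (inj₁ (q≡x , _))    (inj₁ (q≡x′ , _))     = trans (≡.sym q≡x) q≡x′
  Image-injective (inj₁ (q≡x , x∉R))  (inj₂ (q≡fx′ , x′∈L)) = contradiction (subst (_∈ R) (trans (≡.sym q≡fx′) q≡x) (f∈R x′∈L)) x∉R
  Image-injective (inj₂ (q≡fx , x∈L)) (inj₁ (q≡x′ , x′∉R))  = contradiction (subst (_∈ R) (trans (≡.sym q≡fx) q≡x′) (f∈R x∈L)) x′∉R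
  Image-injective (inj₂ (q≡fx , x∈L)) (inj₂ (q≡fx′ , x′∈L)) = f-injective x∈L x′∈L (trans (≡.sym q≡fx) q≡fx′)

  Image-≢v : ∀ {x q} → Image x q → q ≢ v
  Image-≢v (inj₁ (q≡x , x∉R))  q≡v = x∉R (subst (_∈ R) (trans (≡.sym q≡v) q≡x) v∈R)
  Image-≢v (inj₂ (q≡fx , x∈L)) q≡v = f≢v x∈L (trans (≡.sym q≡fx) q≡v)

  -- The new endpoint replacing the endpoint r of a path whose next vertex is c.
  newEnd : Fin n → Fin n → Fin n
  newEnd r c with r ∈? R
  ... | yes _ = f c
  ... | no _  = r

  module _ {r c} (r~c : Edge G r c) (c∉A : c ∉ A) where

    newEnd-edge : Edge G c (newEnd r c)
    newEnd-edge with r ∈? R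
    ... | yes r∈R = f-edge (R-neighbour∈L r∈R r~c c∉A)
    ... | no _    = Edge-sym G r~c

    newEnd-∈A : r ∈ A → newEnd r c ∈ A
    newEnd-∈A r∈A with r ∈? R
    ... | yes r∈R = R⊆A (f∈R (R-neighbour∈L r∈R r~c c∉A))
    ... | no _    = r∈A

    newEnd-image : Image r (newEnd r c) ⊎ Image c (newEnd r c)
    newEnd-image with r ∈? R
    ... | yes r∈R = inj₂ (inj₂ (refl , R-neighbour∈L r∈R r~c c∉A))
    ... | no r∉R  = inj₁ (inj₁ (refl , r∉R))

  module _ {m} (p : Vector (Fin n) (4 + m)) where
    private
      one penult last : Fin (4 + m)
      one    = suc zero
      penult = inject₁ (fromℕ (2 + m))
      last   = fromℕ (3 + m)
      newStart newFinish : Fin n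
      newStart  = newEnd (p zero) (p one)
      newFinish = newEnd (p last) (p penult)

    rerouted : Vector (Fin n) (4 + m)
    rerouted = withEnds newStart newFinish p

    module _ (p-path : IsAPath G A (3 + m) p) where
      private
        p-inner∉A : ∀ a → a ≢ zero → a ≢ last → p a ∉ A
        p-inner∉A = proj₂ (proj₂ (proj₂ (proj₂ (proj₂ p-path))))
        p₀~p₁ : Edge G (p zero) (p one)
        p₀~p₁ = proj₁ (proj₂ p-path) zero
        pₗ~pₗ₋₁ : Edge G (p last) (p penult)
        pₗ~pₗ₋₁ = Edge-sym G (proj₁ (proj₂ p-path) (fromℕ (2 + m)))
        p₁∉A : p one ∉ A
        p₁∉A = p-inner∉A one (λ ()) (λ ())
        pₗ₋₁∉A : p penult ∉ A
        pₗ₋₁∉A = p-inner∉A penult (λ ()) (fromℕ≢inject₁ ∘ ≡.sym)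

      rerouted-image : ∀ a → ∃ λ b → Image (p b) (rerouted a)
      rerouted-image a with endView a
      ... | start = [ (zero ,_) , (one ,_) ]′ (newEnd-image p₀~p₁ p₁∉A)
      ... | inner a≢0 a≢ℓ = a , inj₁ (withEnds-inner newStart newFinish p a≢0 a≢ℓ , p-inner∉A a a≢0 a≢ℓ ∘ R⊆A)
      ... | end   = [ (last ,_) , (penult ,_) ]′ (Sum.map atEnd atEnd (newEnd-image pₗ~pₗ₋₁ pₗ₋₁∉A))
        where
        atEnd : ∀ {x} → Image x newFinish → Image x (rerouted last)
        atEnd = subst (Image _) (≡.sym (withEnds-end newStart newFinish p))

      private
        -- ℓ ≥ 3 makes the positions 0, 1, ℓ - 1 and ℓ pairwise distinct.
        same-position : ∀ {a b} → newStart ≡ newFinish → Image (p a) newStart → Image (p b) newFinish → a ≡ b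
        same-position s≡f i j = proj₁ p-path (Image-injective i (subst (Image _) (≡.sym s≡f) j))

        newStart≢newFinish : newStart ≢ newFinish
        newStart≢newFinish s≡f with newEnd-image p₀~p₁ p₁∉A | newEnd-image pₗ~pₗ₋₁ pₗ₋₁∉A
        ... | inj₁ i | inj₁ j = case same-position s≡f i j of λ ()
        ... | inj₁ i | inj₂ j = case same-position s≡f i j of λ ()
        ... | inj₂ i | inj₁ j = case same-position s≡f i j of λ ()
        ... | inj₂ i | inj₂ j = case same-position s≡f i j of λ ()

      rerouted-isAPath : IsAPath G A (3 + m) rerouted
      rerouted-isAPath = withEnds-isAPath G p-path
        (newEnd-∈A p₀~p₁ p₁∉A (proj₁ (proj₂ (proj₂ p-path))))
        (newEnd-∈A pₗ~pₗ₋₁ pₗ₋₁∉A (proj₁ (proj₂ (proj₂ (proj₂ p-path)))))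
        newStart≢newFinish
        (Edge-sym G (newEnd-edge p₀~p₁ p₁∉A))
        (newEnd-edge pₗ~pₗ₋₁ pₗ₋₁∉A)

  reroute : ∀ {k ℓ} → 3 ≤ ℓ → YesInstance G A k ℓ → YesInstanceAvoiding G A k ℓ v
  reroute (s≤s (s≤s (s≤s _))) (P , paths , disjoint) =
    ((rerouted ∘ P) , (λ i → rerouted-isAPath (P i) (paths i)) , rerouted-disjoint) , rerouted-avoids
    where
    rerouted-disjoint : ∀ i j a b → rerouted (P i) a ≡ rerouted (P j) b → i ≡ j
    rerouted-disjoint i j a b eq with rerouted-image (P i) (paths i) a | rerouted-image (P j) (paths j) b
    ... | c , img | d , img′ = disjoint i j c d (Image-injective img (subst (Image _) (≡.sym eq) img′))
    rerouted-avoids : ∀ i a → rerouted (P i) a ≢ v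
    rerouted-avoids i a = Image-≢v (proj₂ (rerouted-image (P i) (paths i) a))

H1Edge-of-neighbour : ∀ {n} (G : Graph n) {A M : Subset n} {r x} → IsVertexCover G M →
                      r ∈ ∁ M ∩ A → Edge G r x → x ∉ A → H1Edge G A M x r
H1Edge-of-neighbour G {A} {M} {r} {x} cover r∈R₁ r~x x∉A =
  x∈p∧x∉q⇒x∈p─q x∈M x∉A , r∈R₁ , Edge-sym G r~x
  where
  x∈M : x ∈ M
  x∈M = [ contradiction (proj₁ (x∈p∩q⁻ (∁ M) A r∈R₁)) ∘ flip x∈∁p⇒x∉p , id ]′ (cover r x r~x)

mainTheorem7 : ∀ {n} (G : Graph (suc n)) (A : Subset (suc n)) (k ℓ : ℕ) (M : Subset (suc n))
    → 5 ≤ ℓ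
    → IsVertexCover G M
    → 2 * ∣ M ─ A ∣ < ∣ ∁ M ∩ A ∣
    → (Lhat Rhat : Subset (suc n)) (𝓜 : Fin (suc n) → Fin (suc n) → Bool)
    → Lhat ⊆ (M ─ A)
    → Rhat ⊆ (∁ M ∩ A)
    → (∀ u w → 𝓜 u w ≡ true → H1Edge G A M u w)
    → IsTwoExpansion Lhat Rhat 𝓜
    → (∀ u w → w ∈ Rhat → H1Edge G A M u w → u ∈ Lhat)
    → ∣ (∁ M ∩ A) ─ Rhat ∣ ≤ 2 * ∣ (M ─ A) ─ Lhat ∣
    → (v : Fin (suc n))
    → v ∈ Rhat
    → (∀ u → incident 𝓜 u v ≡ false)
    → YesInstance G A k ℓ ⇔ YesInstance (deleteVertex G v) (removeVertex A v) k ℓ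
mainTheorem7 G A k ℓ M 5≤ℓ cover _ Lhat Rhat 𝓜 Lhat⊆L₁ Rhat⊆R₁ 𝓜⊆H₁ expansion N[Rhat]⊆Lhat _ v v∈Rhat v-unmatched =
  mk⇔ (from (yesInstance-deleteVertex G A v) ∘ reroute (≤-trans (m≤m+n 3 2) 5≤ℓ))
      (proj₁ ∘ to (yesInstance-deleteVertex G A v))
  where
  open Equivalence
  Lhat∩Rhat≡∅ : ∀ {x} → x ∈ Lhat → x ∉ Rhat
  Lhat∩Rhat≡∅ x∈Lhat x∈Rhat = x∈∁p⇒x∉p (proj₁ (x∈p∩q⁻ (∁ M) A (Rhat⊆R₁ x∈Rhat))) (p─q⊆p M A (Lhat⊆L₁ x∈Lhat))
  open TwoExpansion Lhat∩Rhat≡∅ expansion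
  open Rerouting G A Rhat Lhat (partner 𝓜) v
    (proj₂ ∘ x∈p∩q⁻ (∁ M) A ∘ Rhat⊆R₁)
    (λ r∈Rhat r~x x∉A → N[Rhat]⊆Lhat _ _ r∈Rhat (H1Edge-of-neighbour G cover (Rhat⊆R₁ r∈Rhat) r~x x∉A))
    (λ x∈Lhat → proj₂ (proj₂ (𝓜⊆H₁ _ _ (partner-matched x∈Lhat))))
    (λ x∈Lhat → proj₂ (proj₁ expansion _ _ (partner-matched x∈Lhat)))
    partner-injective (partner≢unmatched v-unmatched) v∈Rhat
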